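{- Let $m,m',n\in\mathbb{N}$ with $m\le n$. Then $\mu(nm',mm')\le m'\mu(n,m)$ and $\mu^*(nm',mm')\le m'\mu^*(n,m)$.
   Context: $\mathbb{F}_2$ is the field with two elements. For $u\in\mathbb{F}_2^n$, $|u|$ is the number of entries of $u$ equal to $1$. For an $n\times n$ matrix $W$ over $\mathbb{F}_2$, $M(W,0)=\max\{|Wx| : x\in\mathbb{F}_2^n\}$. For $n,m\ge 1$, $A(n,m)$ is the set of $n\times n$ matrices over $\mathbb{F}_2$ with all diagonal entries $1$ and every column containing at most $m$ ones; for $n\ge m$, $A^*(n,m)$ is the subset of those in which every column contains exactly $m$ ones. $\mu(n,m)=\min\{M(W,0):W\in A(n,m)\}$ and $\mu^*(n,m)=\min\{M(W,0):W\in A^*(n,m)\}$. -}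

module Defs where

open import Data.Bool using (Bool; true; false; _∧_; _xor_; T)
open import Data.Nat using (ℕ; zero; suc; _+_; _≤_; _⊓_; _⊔_)
open import Data.Fin using (Fin; zero; suc)
open import Data.List using (List; []; _∷_; [_]; map; concatMap; filter; foldr; allFin)
open import Data.List.Relation.Unary.All using (All)
open import Relation.Nullary using (Dec)
open import Relation.Nullary.Decidable using (_×-dec_)
open import Data.Product using (_×_)
open import Relation.Binary.PropositionalEquality using (_≡_)
import Data.Nat as ℕ
import Data.List.Relation.Unary.All as All

-- Elements of F₂ are represented by Bool (true = 1); addition is xor, multiplication is ∧.
-- An n×n matrix W is a function Fin n → Fin n → Bool with  W i j  = entry in row i, column j.

Vec₂ : ℕ → Set
Vec₂ n = Fin n → Bool

Mat₂ : ℕ → Set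
Mat₂ n = Fin n → Fin n → Bool

xorSum : ∀ {n} → (Fin n → Bool) → Bool
xorSum {zero}  f = false
xorSum {suc n} f = f zero xor xorSum (λ i → f (suc i))

count : ∀ {n} → (Fin n → Bool) → ℕ
count {zero}  f = 0
count {suc n} f = if′ (f zero) + count (λ i → f (suc i))
  where
  if′ : Bool → ℕ
  if′ true  = 1
  if′ false = 0

weight : ∀ {n} → Vec₂ n → ℕ
weight u = count u

_·_ : ∀ {n} → Mat₂ n → Vec₂ n → Vec₂ n
(W · x) i = xorSum (λ j → W i j ∧ x j)

colCount : ∀ {n} → Mat₂ n → Fin n → ℕ
colCount W j = count (λ i → W i j)

cons : ∀ {n} {A : Set} → A → (Fin n → A) → Fin (suc n) → A
cons a f zero    = a
cons a f (suc i) = f i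

allFns : {A : Set} → List A → (n : ℕ) → List (Fin n → A)
allFns xs zero    = [ (λ ()) ]
allFns xs (suc n) = concatMap (λ a → map (cons a) (allFns xs n)) xs

allVec₂ : (n : ℕ) → List (Vec₂ n)
allVec₂ n = allFns (true ∷ false ∷ []) n

allMat₂ : (n : ℕ) → List (Mat₂ n)
allMat₂ n = allFns (allVec₂ n) n

maxL : List ℕ → ℕ
maxL = foldr _⊔_ 0

M₀ : ∀ {n} → Mat₂ n → ℕ
M₀ {n} W = maxL (map (λ x → weight (W · x)) (allVec₂ n))

InA : (n m : ℕ) → Mat₂ n → Set
InA n m W = All (λ i → W i i ≡ true) (allFin n) × All (λ j → colCount W j ≤ m) (allFin n)

InA* : (n m : ℕ) → Mat₂ n → Set
InA* n m W = All (λ i → W i i ≡ true) (allFin n) × All (λ j → colCount W j ≡ m) (allFin n)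

InA? : (n m : ℕ) → (W : Mat₂ n) → Dec (InA n m W)
InA? n m W = All.all? (λ i → W i i Data.Bool.≟ true) (allFin n)
         ×-dec All.all? (λ j → colCount W j ℕ.≤? m) (allFin n)
  where import Data.Bool

InA*? : (n m : ℕ) → (W : Mat₂ n) → Dec (InA* n m W)
InA*? n m W = All.all? (λ i → W i i Data.Bool.≟ true) (allFin n)
          ×-dec All.all? (λ j → colCount W j ℕ.≟ m) (allFin n)
  where import Data.Bool

minL : ℕ → List ℕ → ℕ
minL d = foldr _⊓_ d

-- The default value n is harmless: every M(W,0) ≤ n, and the identity matrix lies in A(n,m)
-- for m ≥ 1; A*(n,m) is nonempty for n ≥ m ≥ 1 (circulant matrices), so the default is never used.
μ : ℕ → ℕ → ℕ
μ n m = minL n (map M₀ (filter (InA? n m) (allMat₂ n)))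

μ* : ℕ → ℕ → ℕ
μ* n m = minL n (map M₀ (filter (InA*? n m) (allMat₂ n)))

-- Blow W ∈ A(n,m) up to the nm′ × nm′ matrix in which every entry of W becomes a
-- constant m′ × m′ block. The diagonal stays 1 and every column gets m′ times as many
-- ones as the column of W it comes from, so the blow-up lies in A(nm′,mm′), and in
-- A*(nm′,mm′) if W ∈ A*(n,m). For x ∈ F₂^{nm′}, the product of the blow-up with x is
-- constant on each block, where it equals Wy for the vector y of block sums of x;
-- hence its weight is m′|Wy| ≤ m′ M(W,0).
module Submission where

open import Defs
open import Data.Nat using (ℕ; _≤_; _*_)
open import Data.Product using (_×_)

open import Data.Bool using (Bool; true; false; _∧_; _xor_)
open import Data.Bool.Properties using (xor-assoc)
open import Data.Fin using (Fin; zero; suc; _↑ˡ_; _↑ʳ_; combine; quotient)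
open import Data.Fin.Properties using (remQuot-combine)
open import Data.List using (List; []; _∷_; map; filter)
open import Data.List.Properties using (map-cong; foldr-preservesᵇ)
open import Data.List.Membership.Propositional using (_∈_)
open import Data.List.Membership.Propositional.Properties
  using (∈-map⁺; ∈-map⁻; ∈-filter⁺; ∈-filter⁻; ∈-concatMap⁺; foldr-selective)
open import Data.List.Relation.Unary.All using (universal)
import Data.List.Relation.Unary.All.Properties as All
open import Data.List.Relation.Unary.Any as Any using (here; there)
open import Data.Nat using (zero; suc; _+_; z≤n)
open import Data.Nat.Properties
open import Data.Product using (∃; _,_; proj₁; proj₂)
open import Data.Sum using (_⊎_; inj₁; inj₂)
open import Function using (_∘_; const)
open import Relation.Binary.Definitions using (_Respects_)
open import Relation.Nullary using (Dec)
open import Relation.Binary.PropositionalEquality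

xorSum-cong : ∀ {n} {f g : Fin n → Bool} → (∀ i → f i ≡ g i) → xorSum f ≡ xorSum g
xorSum-cong {zero}  f≗g = refl
xorSum-cong {suc n} f≗g = cong₂ _xor_ (f≗g zero) (xorSum-cong (f≗g ∘ suc))

count-cong : ∀ {n} {f g : Fin n → Bool} → (∀ i → f i ≡ g i) → count f ≡ count g
count-cong {zero}                f≗g = refl
count-cong {suc n} {f} {g} f≗g with f zero | g zero | f≗g zero
... | true  | .true  | refl = cong suc (count-cong (f≗g ∘ suc))
... | false | .false | refl = count-cong (f≗g ∘ suc)

xorSum-++ : ∀ a b (f : Fin (a + b) → Bool) →
            xorSum f ≡ xorSum (f ∘ (_↑ˡ b)) xor xorSum (f ∘ (a ↑ʳ_))
xorSum-++ zero    b f = refl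
xorSum-++ (suc a) b f = trans (cong (f zero xor_) (xorSum-++ a b (f ∘ suc)))
                              (sym (xor-assoc (f zero) _ _))

count-++ : ∀ a b (f : Fin (a + b) → Bool) →
           count f ≡ count (f ∘ (_↑ˡ b)) + count (f ∘ (a ↑ʳ_))
count-++ zero    b f = refl
count-++ (suc a) b f with f zero
... | true  = cong suc (count-++ a b (f ∘ suc))
... | false = count-++ a b (f ∘ suc)

count-const : ∀ k (c : Bool) → count {k} (const c) ≡ k * count {1} (const c)
count-const zero    c     = refl
count-const (suc k) true  = cong suc (count-const k true)
count-const (suc k) false = count-const k false

∧-distribˡ-xorSum : ∀ {k} c (f : Fin k → Bool) → xorSum (λ j → c ∧ f j) ≡ c ∧ xorSum f
∧-distribˡ-xorSum         true  f = refl
∧-distribˡ-xorSum {zero}  false f = refl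
∧-distribˡ-xorSum {suc k} false f = ∧-distribˡ-xorSum false (f ∘ suc)

xorSum-combine : ∀ n k (f : Fin (n * k) → Bool) →
                 xorSum f ≡ xorSum {n} (λ i → xorSum {k} (λ j → f (combine i j)))
xorSum-combine zero    k f = refl
xorSum-combine (suc n) k f =
  trans (xorSum-++ k (n * k) f)
        (cong (xorSum (f ∘ (_↑ˡ n * k)) xor_) (xorSum-combine n k (f ∘ (k ↑ʳ_))))

count-combine : ∀ n k {f : Fin (n * k) → Bool} {g : Fin n → Bool} →
                (∀ (i : Fin n) (j : Fin k) → f (combine i j) ≡ g i) → count f ≡ k * count g
count-combine zero    k         _   = sym (*-zeroʳ k)
count-combine (suc n) k {f} {g} fib = begin
  count f
    ≡⟨ count-++ k (n * k) f ⟩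
  count (f ∘ (_↑ˡ n * k)) + count (f ∘ (k ↑ʳ_))
    ≡⟨ cong₂ _+_ (count-cong (fib zero)) (count-combine n k (fib ∘ suc)) ⟩
  count {k} (const (g zero)) + k * count (g ∘ suc)
    ≡⟨ cong (_+ k * count (g ∘ suc)) (count-const k (g zero)) ⟩
  k * count {1} (const (g zero)) + k * count (g ∘ suc)
    ≡⟨ sym (*-distribˡ-+ k _ _) ⟩
  k * (count {1} (const (g zero)) + count (g ∘ suc))
    ≡⟨ cong (λ c → k * (c + count (g ∘ suc))) (+-identityʳ _) ⟩
  k * count g ∎
  where open ≡-Reasoning

quotient-combine : ∀ {n k} (i : Fin n) (j : Fin k) → quotient k (combine i j) ≡ i
quotient-combine i j = cong proj₁ (remQuot-combine i j)

blockSum : ∀ {n} k → Vec₂ (n * k) → Vec₂ n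
blockSum k x i = xorSum (λ j → x (combine i j))

xorSum-quotient-∧ : ∀ {n} k (h : Vec₂ n) (x : Vec₂ (n * k)) →
                    xorSum (λ b → h (quotient k b) ∧ x b) ≡ xorSum (λ i → h i ∧ blockSum k x i)
xorSum-quotient-∧ {n} k h x = begin
  xorSum (λ b → h (quotient k b) ∧ x b)
    ≡⟨ xorSum-combine n k (λ b → h (quotient k b) ∧ x b) ⟩
  xorSum {n} (λ i → xorSum {k} (λ j → h (quotient k (combine i j)) ∧ x (combine i j)))
    ≡⟨ xorSum-cong (λ i → xorSum-cong (λ j →
         cong (λ r → h r ∧ x (combine i j)) (quotient-combine i j))) ⟩
  xorSum {n} (λ i → xorSum {k} (λ j → h i ∧ x (combine i j)))
    ≡⟨ xorSum-cong (λ i → ∧-distribˡ-xorSum (h i) (λ j → x (combine i j))) ⟩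
  xorSum (λ i → h i ∧ blockSum k x i) ∎
  where open ≡-Reasoning

_≗₂_ : ∀ {n} → Mat₂ n → Mat₂ n → Set
W ≗₂ W′ = ∀ i j → W i j ≡ W′ i j

weight-·-cong : ∀ {n} {W W′ : Mat₂ n} {x x′ : Vec₂ n} →
                W ≗₂ W′ → (∀ i → x i ≡ x′ i) → weight (W · x) ≡ weight (W′ · x′)
weight-·-cong W≗W′ x≗x′ = count-cong (λ i → xorSum-cong (λ j → cong₂ _∧_ (W≗W′ i j) (x≗x′ j)))

allFns-complete : ∀ {A : Set} (R : A → A → Set) (xs : List A) →
                  (∀ a → ∃ λ a′ → a′ ∈ xs × R a a′) →
                  ∀ n (f : Fin n → A) → ∃ λ g → g ∈ allFns xs n × (∀ i → R (f i) (g i))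
allFns-complete R xs close zero    f = (λ ()) , here refl , λ ()
allFns-complete R xs close (suc n) f
  with close (f zero) | allFns-complete R xs close n (f ∘ suc)
... | a′ , a′∈xs , Ra | g , g∈ , Rg =
  cons a′ g ,
  ∈-concatMap⁺ (λ a → map (cons a) (allFns xs n)) (Any.map (λ { refl → ∈-map⁺ (cons a′) g∈ }) a′∈xs) ,
  λ { zero → Ra ; (suc i) → Rg i }

allVec₂-complete : ∀ n (x : Vec₂ n) → ∃ λ x′ → x′ ∈ allVec₂ n × (∀ i → x i ≡ x′ i)
allVec₂-complete = allFns-complete _≡_ _ λ where
  true  → true  , here refl         , refl
  false → false , there (here refl) , refl

allMat₂-complete : ∀ n (W : Mat₂ n) → ∃ λ W′ → W′ ∈ allMat₂ n × W ≗₂ W′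
allMat₂-complete n = allFns-complete (λ u v → ∀ j → u j ≡ v j) _ (allVec₂-complete n) n

maxL-upper : ∀ {x} (xs : List ℕ) → x ∈ xs → x ≤ maxL xs
maxL-upper (y ∷ xs) (here refl) = m≤m⊔n y (maxL xs)
maxL-upper (y ∷ xs) (there x∈) = ≤-trans (maxL-upper xs x∈) (m≤n⊔m y (maxL xs))

minL-≤-default : ∀ d xs → minL d xs ≤ d
minL-≤-default d []       = ≤-refl
minL-≤-default d (x ∷ xs) = ≤-trans (m⊓n≤n x _) (minL-≤-default d xs)

minL-≤ : ∀ {x} d xs → x ∈ xs → minL d xs ≤ x
minL-≤ d (y ∷ xs) (here refl) = m⊓n≤m y _
minL-≤ d (y ∷ xs) (there x∈)  = ≤-trans (m⊓n≤n y _) (minL-≤ d xs x∈)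

weight-≤-M₀ : ∀ {n} (W : Mat₂ n) x → weight (W · x) ≤ M₀ W
weight-≤-M₀ {n} W x with allVec₂-complete n x
... | x′ , x′∈ , x≗x′ =
  ≤-trans (≤-reflexive (weight-·-cong (λ _ _ → refl) x≗x′))
          (maxL-upper _ (∈-map⁺ (λ y → weight (W · y)) x′∈))

M₀-lub : ∀ {n} (W : Mat₂ n) {K} → (∀ x → weight (W · x) ≤ K) → M₀ W ≤ K
M₀-lub {n} W {K} bound =
  foldr-preservesᵇ {P = _≤ K} ⊔-lub z≤n (All.map⁺ (universal bound (allVec₂ n)))

M₀-cong : ∀ {n} {W W′ : Mat₂ n} → W ≗₂ W′ → M₀ W ≡ M₀ W′
M₀-cong {n} W≗W′ = cong maxL (map-cong (λ x → weight-·-cong {x = x} W≗W′ (λ _ → refl)) (allVec₂ n))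

minM₀ : ∀ {n} {P : Mat₂ n → Set} → ℕ → ((W : Mat₂ n) → Dec (P W)) → ℕ
minM₀ {n} d P? = minL d (map M₀ (filter P? (allMat₂ n)))

minM₀-≤ : ∀ {n} d {P : Mat₂ n → Set} (P? : (W : Mat₂ n) → Dec (P W)) →
          P Respects _≗₂_ → ∀ {W} → P W → minM₀ d P? ≤ M₀ W
minM₀-≤ {n} d P? resp {W} PW with allMat₂-complete n W
... | W′ , W′∈ , W≗W′ =
  ≤-trans (minL-≤ d _ (∈-map⁺ M₀ (∈-filter⁺ P? W′∈ (resp W≗W′ PW))))
          (≤-reflexive (sym (M₀-cong W≗W′)))

minM₀-default-or-attained : ∀ {n} d {P : Mat₂ n → Set} (P? : (W : Mat₂ n) → Dec (P W)) →
                            minM₀ d P? ≡ d ⊎ ∃ λ W → P W × minM₀ d P? ≡ M₀ W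
minM₀-default-or-attained {n} d P? with foldr-selective ⊓-sel d (map M₀ (filter P? (allMat₂ n)))
... | inj₁ default = inj₁ default
... | inj₂ min∈ with ∈-map⁻ M₀ min∈
...   | W , W∈ , eq = inj₂ (W , proj₂ (∈-filter⁻ P? {xs = allMat₂ n} W∈) , eq)

-- N ≤ k * n handles the default value, taken when no matrix satisfies P.
minM₀-scale : ∀ {n N} k {P : Mat₂ n → Set} {Q : Mat₂ N → Set}
              (P? : (W : Mat₂ n) → Dec (P W)) (Q? : (W : Mat₂ N) → Dec (Q W)) →
              Q Respects _≗₂_ → N ≤ k * n →
              (∀ {W} → P W → ∃ λ W′ → Q W′ × M₀ W′ ≤ k * M₀ W) →
              minM₀ N Q? ≤ k * minM₀ n P?
minM₀-scale {n} {N} k P? Q? resp N≤kn lift with minM₀-default-or-attained n P?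
... | inj₁ default rewrite default =
  ≤-trans (minL-≤-default N (map M₀ (filter Q? (allMat₂ N)))) N≤kn
... | inj₂ (W , PW , attained) rewrite attained with lift PW
...   | W′ , QW′ , M₀W′≤ = ≤-trans (minM₀-≤ N Q? resp QW′) M₀W′≤

blowUp : ∀ {n} k → Mat₂ n → Mat₂ (n * k)
blowUp k W a b = W (quotient k a) (quotient k b)

blowUp-· : ∀ {n} k (W : Mat₂ n) x i j → (blowUp k W · x) (combine i j) ≡ (W · blockSum k x) i
blowUp-· k W x i j = begin
  xorSum (λ b → W (quotient k (combine i j)) (quotient k b) ∧ x b)
    ≡⟨ cong (λ r → xorSum (λ b → W r (quotient k b) ∧ x b)) (quotient-combine i j) ⟩
  xorSum (λ b → W i (quotient k b) ∧ x b)
    ≡⟨ xorSum-quotient-∧ k (W i) x ⟩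
  (W · blockSum k x) i ∎
  where open ≡-Reasoning

M₀-blowUp : ∀ {n} k (W : Mat₂ n) → M₀ (blowUp k W) ≤ k * M₀ W
M₀-blowUp {n} k W = M₀-lub (blowUp k W) λ x →
  ≤-trans (≤-reflexive (count-combine n k (blowUp-· k W x)))
          (*-monoʳ-≤ k (weight-≤-M₀ W (blockSum k x)))

colCount-blowUp : ∀ {n} k (W : Mat₂ n) b → colCount (blowUp k W) b ≡ k * colCount W (quotient k b)
colCount-blowUp {n} k W b =
  count-combine n k (λ i j → cong (λ r → W r (quotient k b)) (quotient-combine i j))

InA-respects : ∀ n m → InA n m Respects _≗₂_
InA-respects n m W≗W′ (diag , cols) =
  All.tabulate⁺ (λ i → trans (sym (W≗W′ i i)) (All.tabulate⁻ diag i)) ,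
  All.tabulate⁺ (λ j → ≤-trans (≤-reflexive (count-cong (λ i → sym (W≗W′ i j))))
                               (All.tabulate⁻ cols j))

InA*-respects : ∀ n m → InA* n m Respects _≗₂_
InA*-respects n m W≗W′ (diag , cols) =
  All.tabulate⁺ (λ i → trans (sym (W≗W′ i i)) (All.tabulate⁻ diag i)) ,
  All.tabulate⁺ (λ j → trans (count-cong (λ i → sym (W≗W′ i j))) (All.tabulate⁻ cols j))

blowUp-InA : ∀ {n m} k {W : Mat₂ n} → InA n m W → InA (n * k) (m * k) (blowUp k W)
blowUp-InA {m = m} k {W} (diag , cols) =
  All.tabulate⁺ (λ a → All.tabulate⁻ diag (quotient k a)) ,
  All.tabulate⁺ (λ b → begin
    colCount (blowUp k W) b       ≡⟨ colCount-blowUp k W b ⟩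
    k * colCount W (quotient k b) ≤⟨ *-monoʳ-≤ k (All.tabulate⁻ cols (quotient k b)) ⟩
    k * m                         ≡⟨ *-comm k m ⟩
    m * k                         ∎)
  where open ≤-Reasoning

blowUp-InA* : ∀ {n m} k {W : Mat₂ n} → InA* n m W → InA* (n * k) (m * k) (blowUp k W)
blowUp-InA* {m = m} k {W} (diag , cols) =
  All.tabulate⁺ (λ a → All.tabulate⁻ diag (quotient k a)) ,
  All.tabulate⁺ (λ b → begin
    colCount (blowUp k W) b       ≡⟨ colCount-blowUp k W b ⟩
    k * colCount W (quotient k b) ≡⟨ cong (k *_) (All.tabulate⁻ cols (quotient k b)) ⟩
    k * m                         ≡⟨ *-comm k m ⟩
    m * k                         ∎)
  where open ≡-Reasoning

lemma3p1 : (m m′ n : ℕ) → 1 ≤ m → 1 ≤ m′ → m ≤ n →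
    (μ (n * m′) (m * m′) ≤ m′ * μ n m) × (μ* (n * m′) (m * m′) ≤ m′ * μ* n m)
lemma3p1 m m′ n _ _ _ =
  minM₀-scale m′ (InA? n m) (InA? (n * m′) (m * m′)) (InA-respects _ _) nm′≤m′n
    (λ {W} W∈A → blowUp m′ W , blowUp-InA m′ W∈A , M₀-blowUp m′ W) ,
  minM₀-scale m′ (InA*? n m) (InA*? (n * m′) (m * m′)) (InA*-respects _ _) nm′≤m′n
    (λ {W} W∈A* → blowUp m′ W , blowUp-InA* m′ W∈A* , M₀-blowUp m′ W)
  where
  nm′≤m′n : n * m′ ≤ m′ * n
  nm′≤m′n = ≤-reflexive (*-comm n m′)
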